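{- Let $N$ be a positive integer and let $\mathcal{F}$ be a collection of distinct subsets of $\{1,2,\ldots,N\}$ such that every $s\in\mathcal{F}$ has even cardinality. For every integer $j$, if $|\mathcal{F}|>N+j$, then $\mathcal{F}$ contains at least $\lceil j/2\rceil$ pairwise disjoint pairs $(s_i,s_j)$ of distinct members of $\mathcal{F}$ (i.e., no member of $\mathcal{F}$ belongs to two of the pairs) such that for each pair the union $s_i\cup s_j$ has even cardinality. -}

module Defs where

open import Data.Nat using (ℕ; _+_; _/_)
open import Data.Nat.Divisibility using (_∣_)
open import Data.Integer using (ℤ; +_; -[1+_]; -_)
open import Data.Fin.Subset using (Subset; ∣_∣)
open import Data.List using (List; []; _∷_; concatMap)
open import Data.Product using (_×_; _,_)

ceilHalf : ℤ → ℤ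
ceilHalf (+ n)      = + ((n + 1) / 2)
ceilHalf (-[1+ n ]) = - (+ ((n + 1) / 2))

EvenCard : {N : ℕ} → Subset N → Set
EvenCard s = 2 ∣ ∣ s ∣

members : {A : Set} → List (A × A) → List A
members = concatMap (λ { (a , b) → a ∷ b ∷ [] })

{-# OPTIONS --safe #-}
-- Since |s ∪ t| ≡ |s| + |t| + |s ∩ t| (mod 2), for even sets an odd union means an odd
-- intersection. A family of distinct even subsets of {1..N} with pairwise odd intersections
-- has at most N + 1 members ("reverse Oddtown"): otherwise, setting one member t aside, the
-- remaining characteristic vectors are linearly dependent, and pairing a vanishing sum
-- y + Σ ys with t and with y gives contradictory parities for |ys|. Hence any N + 2 members
-- contain a pair with even union; removing such pairs greedily while at least N + 2 sets
-- remain produces ⌈j/2⌉ disjoint pairs.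
module Submission where

open import Defs
open import Data.Nat using (ℕ; NonZero)
open import Data.Integer using (ℤ; +_; _+_; _<_; _≤_)
open import Data.Fin.Subset using (Subset; _∪_)
open import Data.List using (List; length)
open import Data.List.Relation.Unary.All using (All)
open import Data.List.Relation.Unary.Unique.Propositional using (Unique)
open import Data.List.Membership.Propositional using (_∈_)
open import Data.Product using (Σ; _×_; proj₁; proj₂)

open import Algebra.Bundles using (CommutativeSemigroup; CommutativeRing)
import Algebra.Properties.CommutativeSemigroup as CommutativeSemigroupProperties
open import Data.Bool using (Bool; true; false; not; _∧_; _∨_; _xor_)
import Data.Bool as Bool
open import Data.Bool.Properties
  using (xor-assoc; xor-comm; xor-identityˡ; xor-identityʳ; xor-same; xor-inverseˡ; xor-∧-commutativeRing
        ; ∧-distribʳ-xor; ∧-zeroˡ; ∧-idem; ¬-not; not-¬; not-involutive)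
open import Data.Fin.Subset using (⊥; _∩_; ∣_∣)
open import Data.Integer using (-[1+_]; +≤+; +<+)
open import Data.Integer.Properties using (neg-≤-pos)
open import Data.List using ([]; _∷_; _++_; map; foldr)
open import Data.List.Properties using (map-id)
open import Data.List.Membership.Propositional using (find; lose)
open import Data.List.Membership.Propositional.Properties using (∈-∃++; ∈-++⁺ˡ)
open import Data.List.Relation.Binary.Permutation.Propositional
  using (_↭_; ↭-refl; ↭-sym; ↭-trans; prep; ↭⇒↭ₛ)
open import Data.List.Relation.Binary.Permutation.Propositional.Properties
  using (shift; ↭-length; ∈-resp-↭; All-resp-↭)
import Data.List.Relation.Binary.Permutation.Setoid.Properties as PermutationSetoid
open import Data.List.Relation.Unary.All using ([]; _∷_)
import Data.List.Relation.Unary.All as All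
open import Data.List.Relation.Unary.All.Properties using (¬Any⇒All¬; ++⁻ˡ; map⁺)
open import Data.List.Relation.Unary.AllPairs using ([]; _∷_)
open import Data.List.Relation.Unary.Any using (here; there; any?)
open import Data.Nat using (zero; suc; z≤n; s≤s)
import Data.Nat as ℕ
open import Data.Nat.Divisibility
  using (_∣_; _∣?_; _∣0; ∣-refl; ∣1⇒≡1; ∣m∣n⇒∣m+n; ∣m+n∣m⇒∣n)
open import Data.Nat.DivMod using (_/_; m/n*n≤m)
open import Data.Nat.Properties
  using (≤-pred; ≤-trans; <-trans; <⇒≱; n<1+n; m≤n+m; ≮⇒≥; +-monoˡ-≤; +-comm; module ≤-Reasoning)
open import Data.Product using (∃; ∃₂; _,_)
open import Data.Sum using (_⊎_; inj₁; inj₂)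
open import Data.Vec using (Vec; []; _∷_; zipWith; head; tail)
open import Data.Vec.Properties
  using (zipWith-assoc; zipWith-comm; zipWith-identityˡ; zipWith-identityʳ; zipWith-distribʳ
        ; zipWith-zeroˡ; zipWith-idem; ≡-dec)
open import Function using (_∘_; id)
open import Level using (0ℓ)
open import Relation.Binary.PropositionalEquality
  using (_≡_; _≢_; refl; sym; trans; cong; cong₂; subst; setoid; module ≡-Reasoning)
open import Relation.Binary.PropositionalEquality.Algebra using (isMagma)
open import Relation.Nullary using (¬_; yes; no; ¬?; _×-dec_; contradiction)

private
  variable
    A : Set
    n : ℕ

∈⇒↭∷ : {x : A} {xs : List A} → x ∈ xs → ∃ λ ys → xs ↭ x ∷ ys
∈⇒↭∷ x∈xs with ∈-∃++ x∈xs
... | ps , qs , refl = ps ++ qs , shift _ ps qs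

∈∈⇒↭∷∷ : {x y : A} {xs : List A} → x ∈ xs → y ∈ xs → x ≢ y →
         ∃ λ zs → xs ↭ x ∷ y ∷ zs
∈∈⇒↭∷∷ x∈xs y∈xs x≢y with ∈⇒↭∷ x∈xs
... | ys , xs↭ with ∈-resp-↭ xs↭ y∈xs
...   | here y≡x    = contradiction (sym y≡x) x≢y
...   | there y∈ys with ∈⇒↭∷ y∈ys
...     | zs , ys↭ = zs , ↭-trans xs↭ (prep _ ys↭)

Unique-resp-↭ : {xs ys : List A} → xs ↭ ys → Unique xs → Unique ys
Unique-resp-↭ {A = A} xs↭ys = PermutationSetoid.Unique-resp-↭ (setoid A) (↭⇒↭ₛ xs↭ys)

open CommutativeSemigroupProperties
  (CommutativeRing.+-commutativeSemigroup xor-∧-commutativeRing)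
  using () renaming (interchange to xor-interchange)

infixl 6 _⊕_

-- GF(2)-vectors are Bool vectors, i.e. subsets; the empty subset ⊥ is the zero vector.
_⊕_ : Vec Bool n → Vec Bool n → Vec Bool n
_⊕_ = zipWith _xor_

⊕-assoc : (u v w : Vec Bool n) → u ⊕ v ⊕ w ≡ u ⊕ (v ⊕ w)
⊕-assoc = zipWith-assoc xor-assoc

⊕-commutativeSemigroup : ℕ → CommutativeSemigroup 0ℓ 0ℓ
⊕-commutativeSemigroup n = record
  { isCommutativeSemigroup = record
    { isSemigroup = record { isMagma = isMagma (_⊕_ {n}) ; assoc = ⊕-assoc }
    ; comm        = zipWith-comm xor-comm
    }
  }

module _ {n : ℕ} where
  open CommutativeSemigroupProperties (⊕-commutativeSemigroup n) public
    using () renaming (interchange to ⊕-interchange; xy∙z≈xz∙y to ⊕-swapʳ)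

⊕-identityˡ : (u : Vec Bool n) → ⊥ ⊕ u ≡ u
⊕-identityˡ = zipWith-identityˡ xor-identityˡ

⊕-identityʳ : (u : Vec Bool n) → u ⊕ ⊥ ≡ u
⊕-identityʳ = zipWith-identityʳ xor-identityʳ

⊕-self : (u : Vec Bool n) → u ⊕ u ≡ ⊥
⊕-self []      = refl
⊕-self (a ∷ u) = cong₂ _∷_ (xor-same a) (⊕-self u)

⊕≡⊥⇒≡ : (u v : Vec Bool n) → u ⊕ v ≡ ⊥ → u ≡ v
⊕≡⊥⇒≡ u v u⊕v≡⊥ = begin
  u             ≡⟨ sym (⊕-identityʳ u) ⟩
  u ⊕ ⊥         ≡⟨ cong (u ⊕_) (sym (⊕-self v)) ⟩
  u ⊕ (v ⊕ v)   ≡⟨ sym (⊕-assoc u v v) ⟩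
  u ⊕ v ⊕ v     ≡⟨ cong (_⊕ v) u⊕v≡⊥ ⟩
  ⊥ ⊕ v         ≡⟨ ⊕-identityˡ v ⟩
  v             ∎
  where open ≡-Reasoning

head-⊕ : (u v : Vec Bool (suc n)) → head (u ⊕ v) ≡ head u xor head v
head-⊕ (a ∷ u) (b ∷ v) = refl

sum : List (Vec Bool n) → Vec Bool n
sum = foldr _⊕_ ⊥

par : Vec Bool n → Bool
par []      = false
par (a ∷ u) = a xor par u

dot : Vec Bool n → Vec Bool n → Bool
dot u v = par (u ∩ v)

par-⊥ : ∀ n → par (⊥ {n}) ≡ false
par-⊥ zero    = refl
par-⊥ (suc n) = par-⊥ n

par-⊕ : (u v : Vec Bool n) → par (u ⊕ v) ≡ par u xor par v
par-⊕ []      []      = refl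
par-⊕ (a ∷ u) (b ∷ v) =
  trans (cong ((a xor b) xor_) (par-⊕ u v)) (xor-interchange a b (par u) (par v))

∨-as-xor : ∀ a b → a ∨ b ≡ (a xor b) xor (a ∧ b)
∨-as-xor true  b = sym (xor-inverseˡ b)
∨-as-xor false b = sym (xor-identityʳ b)

∪-as-⊕ : (s t : Subset n) → s ∪ t ≡ s ⊕ t ⊕ (s ∩ t)
∪-as-⊕ []      []      = refl
∪-as-⊕ (a ∷ s) (b ∷ t) = cong₂ _∷_ (∨-as-xor a b) (∪-as-⊕ s t)

par-∪ : (s t : Subset n) → par (s ∪ t) ≡ (par s xor par t) xor dot s t
par-∪ s t = begin
  par (s ∪ t)                   ≡⟨ cong par (∪-as-⊕ s t) ⟩
  par (s ⊕ t ⊕ (s ∩ t))         ≡⟨ par-⊕ (s ⊕ t) (s ∩ t) ⟩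
  par (s ⊕ t) xor dot s t       ≡⟨ cong (_xor dot s t) (par-⊕ s t) ⟩
  (par s xor par t) xor dot s t ∎
  where open ≡-Reasoning

dot-⊕ˡ : (u v w : Vec Bool n) → dot (u ⊕ v) w ≡ dot u w xor dot v w
dot-⊕ˡ u v w = trans (cong par (zipWith-distribʳ ∧-distribʳ-xor w u v)) (par-⊕ (u ∩ w) (v ∩ w))

dot-⊥ˡ : (w : Vec Bool n) → dot ⊥ w ≡ false
dot-⊥ˡ {n} w = trans (cong par (zipWith-zeroˡ ∧-zeroˡ w)) (par-⊥ n)

dot-self : (u : Vec Bool n) → dot u u ≡ par u
dot-self u = cong par (zipWith-idem ∧-idem u)

isOdd : ℕ → Bool
isOdd zero    = false
isOdd (suc n) = not (isOdd n)

2∣⇒¬isOdd : ∀ n → 2 ∣ n → isOdd n ≡ false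
2∣⇒¬isOdd zero          _   = refl
2∣⇒¬isOdd (suc zero)    2∣1 with () ← ∣1⇒≡1 2∣1
2∣⇒¬isOdd (suc (suc n)) 2∣n+2 =
  trans (not-involutive (isOdd n)) (2∣⇒¬isOdd n (∣m+n∣m⇒∣n 2∣n+2 ∣-refl))

¬isOdd⇒2∣ : ∀ n → isOdd n ≡ false → 2 ∣ n
¬isOdd⇒2∣ zero          _ = 2 ∣0
¬isOdd⇒2∣ (suc (suc n)) e =
  ∣m∣n⇒∣m+n ∣-refl (¬isOdd⇒2∣ n (trans (sym (not-involutive (isOdd n))) e))

par≡isOdd∣∣ : (s : Subset n) → par s ≡ isOdd ∣ s ∣
par≡isOdd∣∣ []          = refl
par≡isOdd∣∣ (true ∷ s)  = cong not (par≡isOdd∣∣ s)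
par≡isOdd∣∣ (false ∷ s) = par≡isOdd∣∣ s

evenCard⇒¬par : (s : Subset n) → EvenCard s → par s ≡ false
evenCard⇒¬par s 2∣∣s∣ = trans (par≡isOdd∣∣ s) (2∣⇒¬isOdd ∣ s ∣ 2∣∣s∣)

¬par⇒evenCard : (s : Subset n) → par s ≡ false → EvenCard s
¬par⇒evenCard s ¬par = ¬isOdd⇒2∣ ∣ s ∣ (trans (sym (par≡isOdd∣∣ s)) ¬par)

oddUnion⇒oddDot : (s t : Subset n) → EvenCard s → EvenCard t → ¬ EvenCard (s ∪ t) →
                  dot s t ≡ true
oddUnion⇒oddDot s t even-s even-t odd-s∪t =
  ¬-not λ dot≡false → odd-s∪t (¬par⇒evenCard (s ∪ t) (begin
  par (s ∪ t)                   ≡⟨ par-∪ s t ⟩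
  (par s xor par t) xor dot s t ≡⟨ cong₂ (λ a b → (a xor b) xor dot s t)
                                         (evenCard⇒¬par s even-s) (evenCard⇒¬par t even-t) ⟩
  dot s t                       ≡⟨ dot≡false ⟩
  false                         ∎))
  where open ≡-Reasoning

eliminate : Vec Bool n → Vec Bool (suc n) → Vec Bool n
eliminate w (false ∷ v) = v
eliminate w (true  ∷ v) = v ⊕ w

eliminate-⊕ : (w : Vec Bool n) (u v : Vec Bool (suc n)) →
              eliminate w (u ⊕ v) ≡ eliminate w u ⊕ eliminate w v
eliminate-⊕ w (false ∷ u) (false ∷ v) = refl
eliminate-⊕ w (false ∷ u) (true  ∷ v) = ⊕-assoc u v w
eliminate-⊕ w (true  ∷ u) (false ∷ v) = ⊕-swapʳ u v w
eliminate-⊕ w (true  ∷ u) (true  ∷ v) = begin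
  u ⊕ v               ≡⟨ sym (⊕-identityʳ (u ⊕ v)) ⟩
  u ⊕ v ⊕ ⊥           ≡⟨ cong (u ⊕ v ⊕_) (sym (⊕-self w)) ⟩
  u ⊕ v ⊕ (w ⊕ w)     ≡⟨ ⊕-interchange u v w w ⟩
  u ⊕ w ⊕ (v ⊕ w)     ∎
  where open ≡-Reasoning

eliminate-sum : (w : Vec Bool n) (f : A → Vec Bool (suc n)) (xs : List A) →
                sum (map (eliminate w ∘ f) xs) ≡ eliminate w (sum (map f xs))
eliminate-sum w f []       = refl
eliminate-sum w f (x ∷ xs) =
  trans (cong (eliminate w (f x) ⊕_) (eliminate-sum w f xs)) (sym (eliminate-⊕ w (f x) _))

eliminate≡⊥ : (w : Vec Bool n) (v : Vec Bool (suc n)) → eliminate w v ≡ ⊥ →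
              v ≡ ⊥ ⊎ v ≡ true ∷ w
eliminate≡⊥ w (false ∷ v) v≡⊥   = inj₁ (cong (false ∷_) v≡⊥)
eliminate≡⊥ w (true  ∷ v) v⊕w≡⊥ = inj₂ (cong (true ∷_) (⊕≡⊥⇒≡ v w v⊕w≡⊥))

head-sum : (vs : List (Vec Bool (suc n))) → All (λ v → head v ≡ false) vs → head (sum vs) ≡ false
head-sum []       []       = refl
head-sum (v ∷ vs) (h ∷ hs) = trans (head-⊕ v (sum vs)) (cong₂ _xor_ h (head-sum vs hs))

record Dependency (f : A → Vec Bool n) (xs : List A) : Set where
  constructor dependency
  field
    lead     : A
    support  : List A
    rest     : List A
    split    : xs ↭ lead ∷ support ++ rest
    vanishes : sum (map f (lead ∷ support)) ≡ ⊥

Dependency-resp-↭ : {f : A → Vec Bool n} {xs ys : List A} →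
                    xs ↭ ys → Dependency f ys → Dependency f xs
Dependency-resp-↭ xs↭ys (dependency y ys zs split vanishes) =
  dependency y ys zs (↭-trans xs↭ys split) vanishes

dependency-pivot : {f : A → Vec Bool (suc n)} {xs : List A} {w : Vec Bool n} (p : A) →
                   f p ≡ true ∷ w → Dependency (eliminate w ∘ f) xs → Dependency f (p ∷ xs)
dependency-pivot {f = f} {w = w} p fp≡ (dependency y ys zs split vanishes)
  with eliminate≡⊥ w (sum (map f (y ∷ ys))) (trans (sym (eliminate-sum w f (y ∷ ys))) vanishes)
... | inj₁ Σ≡⊥ =
  dependency y ys (p ∷ zs) (↭-trans (prep p split) (↭-sym (shift p (y ∷ ys) zs))) Σ≡⊥
... | inj₂ Σ≡fp = dependency p (y ∷ ys) zs (prep p split)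
                    (trans (cong (f p ⊕_) (trans Σ≡fp (sym fp≡))) (⊕-self (f p)))

dependency-headless : {f : A → Vec Bool (suc n)} {xs : List A} →
                      All (λ a → head (f a) ≡ false) xs → Dependency (eliminate ⊥ ∘ f) xs → Dependency f xs
dependency-headless {f = f} heads (dependency y ys zs split vanishes)
  with eliminate≡⊥ ⊥ (sum (map f (y ∷ ys))) (trans (sym (eliminate-sum ⊥ f (y ∷ ys))) vanishes)
... | inj₁ Σ≡⊥ = dependency y ys zs split Σ≡⊥
... | inj₂ Σ≡1 = contradiction (cong head Σ≡1)
                   (not-¬ (head-sum (map f (y ∷ ys)) (map⁺ (++⁻ˡ (y ∷ ys) (All-resp-↭ split heads)))))

dependent : ∀ n (f : A → Vec Bool n) (xs : List A) → n ℕ.< length xs → Dependency f xs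
dependent zero f (x ∷ xs) _ = dependency x [] xs ↭-refl (empty (f x ⊕ ⊥) ⊥)
  where empty : (u v : Vec Bool 0) → u ≡ v
        empty [] [] = refl
dependent (suc n) f xs n<∣xs∣ with any? (λ a → head (f a) Bool.≟ true) xs
... | no no-pivot =
  -- all first coordinates vanish, so eliminating against ⊥ merely drops them
  dependency-headless (All.map ¬-not (¬Any⇒All¬ xs no-pivot))
    (dependent n (eliminate ⊥ ∘ f) xs (<-trans (n<1+n n) n<∣xs∣))
... | yes has-pivot with find has-pivot
...   | p , p∈xs , head≡true with ∈⇒↭∷ p∈xs
...     | xs′ , xs↭ =
  Dependency-resp-↭ xs↭ (dependency-pivot p (head-tail head≡true)
    (dependent n (eliminate (tail (f p)) ∘ f) xs′
      (≤-pred (subst (suc n ℕ.<_) (↭-length xs↭) n<∣xs∣))))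
  where head-tail : {v : Vec Bool (suc n)} → head v ≡ true → v ≡ true ∷ tail v
        head-tail {_ ∷ _} refl = refl

dot-sum : (w : Vec Bool n) (vs : List (Vec Bool n)) → All (λ v → dot v w ≡ true) vs →
          dot (sum vs) w ≡ isOdd (length vs)
dot-sum w []       []       = dot-⊥ˡ w
dot-sum w (v ∷ vs) (o ∷ os) = trans (dot-⊕ˡ v (sum vs) w) (cong₂ _xor_ o (dot-sum w vs os))

PairwiseOdd : List (Vec Bool n) → Set
PairwiseOdd vs = ∀ {u v} → u ∈ vs → v ∈ vs → u ≢ v → dot u v ≡ true

reverse-oddtown : (vs : List (Vec Bool n)) → Unique vs → All (λ v → par v ≡ false) vs →
                  PairwiseOdd vs → length vs ℕ.≤ suc n
reverse-oddtown     []       _                  _    _   = z≤n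
reverse-oddtown {n} (t ∷ vs) (t∉vs ∷ unique-vs) even odd =
  s≤s (≮⇒≥ λ n<∣vs∣ → independent (dependent n id vs n<∣vs∣))
  where
  independent : ¬ Dependency id vs
  independent (dependency y ys zs split vanishes) = not-¬ even-∣y∷ys∣ (cong not even-∣ys∣)
    where
    open ≡-Reasoning
    member : ∀ {v} → v ∈ y ∷ ys → v ∈ vs
    member v∈ = ∈-resp-↭ (↭-sym split) (∈-++⁺ˡ v∈)
    y∉ys : All (y ≢_) ys
    y∉ys with y∉ ∷ _ ← Unique-resp-↭ split unique-vs = ++⁻ˡ ys y∉
    y⊕Σys≡⊥ : y ⊕ sum ys ≡ ⊥
    y⊕Σys≡⊥ = trans (cong sum (sym (map-id (y ∷ ys)))) vanishes
    odd-with-t : All (λ v → dot v t ≡ true) (y ∷ ys)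
    odd-with-t = All.tabulate λ v∈ →
      odd (there (member v∈)) (here refl) λ v≡t → All.lookup t∉vs (member v∈) (sym v≡t)
    odd-with-y : All (λ v → dot v y ≡ true) ys
    odd-with-y = All.tabulate λ v∈ →
      odd (there (member (there v∈))) (there (member (here refl)))
          λ v≡y → All.lookup y∉ys v∈ (sym v≡y)
    even-∣y∷ys∣ : isOdd (length (y ∷ ys)) ≡ false
    even-∣y∷ys∣ = begin
      isOdd (length (y ∷ ys)) ≡⟨ sym (dot-sum t (y ∷ ys) odd-with-t) ⟩
      dot (y ⊕ sum ys) t      ≡⟨ cong (λ s → dot s t) y⊕Σys≡⊥ ⟩
      dot ⊥ t                 ≡⟨ dot-⊥ˡ t ⟩
      false                   ∎
    even-∣ys∣ : isOdd (length ys) ≡ false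
    even-∣ys∣ = begin
      isOdd (length ys) ≡⟨ sym (dot-sum y ys odd-with-y) ⟩
      dot (sum ys) y    ≡⟨ cong (λ s → dot s y) (sym (⊕≡⊥⇒≡ y (sum ys) y⊕Σys≡⊥)) ⟩
      dot y y           ≡⟨ dot-self y ⟩
      par y             ≡⟨ All.lookup even (there (member (here refl))) ⟩
      false             ∎

evenUnionPair : (F : List (Subset n)) → Unique F → All EvenCard F → 2 ℕ.+ n ℕ.≤ length F →
                ∃₂ λ s t → ∃ λ R → F ↭ s ∷ t ∷ R × EvenCard (s ∪ t)
evenUnionPair F unique even n+2≤∣F∣
  with any? (λ s → any? (λ t → ¬? (≡-dec Bool._≟_ s t) ×-dec (2 ∣? ∣ s ∪ t ∣)) F) F
... | yes some with find some
...   | s , s∈F , some-t with find some-t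
...     | t , t∈F , s≢t , even-s∪t with ∈∈⇒↭∷∷ s∈F t∈F s≢t
...       | R , F↭ = s , t , R , F↭ , even-s∪t
evenUnionPair F unique even n+2≤∣F∣ | no none =
  contradiction (reverse-oddtown F unique (All.map (λ {s} → evenCard⇒¬par s) even) pairwise-odd)
                (<⇒≱ n+2≤∣F∣)
  where
  pairwise-odd : PairwiseOdd F
  pairwise-odd {s} {t} s∈F t∈F s≢t = oddUnion⇒oddDot s t (All.lookup even s∈F) (All.lookup even t∈F)
    λ even-s∪t → none (lose s∈F (lose t∈F (s≢t , even-s∪t)))

EvenPairs : List (Subset n) → ℕ → Set
EvenPairs {n} F k = Σ (List (Subset n × Subset n)) λ P →
  (k ℕ.≤ length P)
  × All (λ p → EvenCard (proj₁ p ∪ proj₂ p)) P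
  × All (λ s → s ∈ F) (members P)
  × Unique (members P)

EvenPairs-∷ : {F R : List (Subset n)} {s t : Subset n} {k : ℕ} →
              F ↭ s ∷ t ∷ R → Unique (s ∷ t ∷ R) → EvenCard (s ∪ t) → EvenPairs R k → EvenPairs F (suc k)
EvenPairs-∷ {F = F} {R} {s} {t} F↭ ((s≢t ∷ s∉R) ∷ t∉R ∷ _) even-s∪t
            (P , k≤∣P∣ , even-P , P⊆R , unique-P) =
  (s , t) ∷ P , s≤s k≤∣P∣ , even-s∪t ∷ even-P ,
  in-F (here refl) ∷ in-F (there (here refl)) ∷ All.map (in-F ∘ there ∘ there) P⊆R ,
  (s≢t ∷ All.map (All.lookup s∉R) P⊆R) ∷ All.map (All.lookup t∉R) P⊆R ∷ unique-P
  where in-F : ∀ {x} → x ∈ s ∷ t ∷ R → x ∈ F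
        in-F = ∈-resp-↭ (↭-sym F↭)

evenPairs : ∀ k (F : List (Subset n)) → Unique F → All EvenCard F →
            k ℕ.* 2 ℕ.+ n ℕ.≤ length F → EvenPairs F k
evenPairs     zero    F _      _    _     = [] , z≤n , [] , [] , []
evenPairs {n} (suc k) F unique even bound
  with s , t , R , F↭ , even-s∪t ←
         evenUnionPair F unique even (≤-trans (s≤s (s≤s (m≤n+m n (k ℕ.* 2)))) bound)
  with unique-stR ← Unique-resp-↭ F↭ unique
  with _ ∷ _ ∷ even-R ← All-resp-↭ F↭ even
  with _ ∷ _ ∷ unique-R ← unique-stR =
  EvenPairs-∷ F↭ unique-stR even-s∪t
    (evenPairs k R unique-R even-R
      (≤-pred (≤-pred (subst (suc (suc (k ℕ.* 2 ℕ.+ n)) ℕ.≤_) (↭-length F↭) bound))))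

corollary2p3 : (N : ℕ) → .{{_ : NonZero N}} → (F : List (Subset N)) → Unique F
    → All EvenCard F → (j : ℤ) → + N + j < + length F
    → Σ (List (Subset N × Subset N)) λ P →
        (ceilHalf j ≤ + length P)
        × All (λ p → EvenCard (proj₁ p ∪ proj₂ p)) P
        × All (λ s → s ∈ F) (members P)
        × Unique (members P)
corollary2p3 N F unique even -[1+ j ] _               = [] , neg-≤-pos , [] , [] , []
corollary2p3 N F unique even (+ j)    (+<+ N+j<∣F∣) =
  let P , ⌈j/2⌉≤∣P∣ , pairs = evenPairs ((j ℕ.+ 1) / 2) F unique even bound
  in  P , +≤+ ⌈j/2⌉≤∣P∣ , pairs
  where
  open ≤-Reasoning
  bound : (j ℕ.+ 1) / 2 ℕ.* 2 ℕ.+ N ℕ.≤ length F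
  bound = begin
    (j ℕ.+ 1) / 2 ℕ.* 2 ℕ.+ N ≤⟨ +-monoˡ-≤ N (m/n*n≤m (j ℕ.+ 1) 2) ⟩
    j ℕ.+ 1 ℕ.+ N             ≡⟨ cong (ℕ._+ N) (+-comm j 1) ⟩
    suc (j ℕ.+ N)             ≡⟨ cong suc (+-comm j N) ⟩
    suc (N ℕ.+ j)             ≤⟨ N+j<∣F∣ ⟩
    length F                  ∎
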